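{- Let $T$ be a sound, effectively axiomatized extension of $\mathsf{EA}$, and let $\mathfrak{A}$ be constructed as in the context. At any stage of the construction of $\mathfrak{A}$, (i) exactly one of the sentences that are active at the end of that stage is true in the standard model $\mathbb{N}$, and (ii) exactly one of the sentences numerated into $\mathfrak{A}$ at that stage is true in $\mathbb{N}$.
   Context: $\mathsf{Con}_T(\psi)$ denotes the arithmetized sentence expressing the consistency of $T+\psi$. Let $\varphi_0,\varphi_1,\dots$ be an effective Gödel numbering (enumeration) of the sentences of arithmetic. The set $\mathfrak{A}$ is built in stages; at a stage a sentence may be activated, and it remains active until deactivated at a later stage. Stage 0: numerate $\varphi_0$ and $\neg\varphi_0$ into $\mathfrak{A}$, and activate $\varphi_0\wedge\mathsf{Con}_T(\varphi_0)$ and $\neg\varphi_0\wedge\mathsf{Con}_T(\neg\varphi_0)$. Stage $n+1$: for each of the finitely many active sentences $\psi$, numerate $\theta_0:=\psi\wedge\varphi_{n+1}$ and $\theta_1:=\psi\wedge\neg\varphi_{n+1}$ into $\mathfrak{A}$, deactivate $\psi$, and activate $\theta_0\wedge\mathsf{Con}_T(\theta_0)$ and $\theta_1\wedge\mathsf{Con}_T(\theta_1)$. -}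

module Defs where

open import Data.Nat using (ℕ; zero; suc; _+_; _*_; _^_; _≤_)
open import Data.Fin using (Fin; zero; suc)
open import Data.Bool using (Bool; true)
open import Data.List using (List; []; _∷_; map; concatMap)
open import Data.List.Membership.Propositional using (_∈_)
open import Data.List.Relation.Unary.All using (All)
open import Data.Product using (Σ; _×_; _,_; ∃)
open import Data.Sum using (_⊎_)
open import Data.Empty using (⊥)
open import Relation.Nullary using (¬_)
open import Relation.Binary.PropositionalEquality using (_≡_)

-- Syntax of first-order arithmetic in the language of EA:
-- 0, S, +, ·, exp (x ↦ 2^x), ≤.  Terms/formulas indexed by the
-- number of free variables (de Bruijn).

data Term (n : ℕ) : Set where
  var  : Fin n → Term n
  𝟎    : Term n
  S'   : Term n → Term n
  _+'_ : Term n → Term n → Term n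
  _*'_ : Term n → Term n → Term n
  exp' : Term n → Term n

infix  7 _≐_ _≤'_
infixr 6 _∧'_
infixr 5 _∨'_
infixr 4 _⇒_

data Formula (n : ℕ) : Set where
  ⊥'   : Formula n
  _≐_  : Term n → Term n → Formula n
  _≤'_ : Term n → Term n → Formula n
  _∧'_ : Formula n → Formula n → Formula n
  _∨'_ : Formula n → Formula n → Formula n
  _⇒_  : Formula n → Formula n → Formula n
  ∀'   : Formula (suc n) → Formula n
  ∃'   : Formula (suc n) → Formula n

¬'_ : ∀ {n} → Formula n → Formula n
¬' φ = φ ⇒ ⊥'

Sentence : Set
Sentence = Formula 0

extR : ∀ {n m} → (Fin n → Fin m) → Fin (suc n) → Fin (suc m)
extR ρ zero    = zero
extR ρ (suc i) = suc (ρ i)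

renT : ∀ {n m} → (Fin n → Fin m) → Term n → Term m
renT ρ (var i)  = var (ρ i)
renT ρ 𝟎        = 𝟎
renT ρ (S' t)   = S' (renT ρ t)
renT ρ (t +' u) = renT ρ t +' renT ρ u
renT ρ (t *' u) = renT ρ t *' renT ρ u
renT ρ (exp' t) = exp' (renT ρ t)

renF : ∀ {n m} → (Fin n → Fin m) → Formula n → Formula m
renF ρ ⊥'       = ⊥'
renF ρ (t ≐ u)  = renT ρ t ≐ renT ρ u
renF ρ (t ≤' u) = renT ρ t ≤' renT ρ u
renF ρ (φ ∧' ψ) = renF ρ φ ∧' renF ρ ψ
renF ρ (φ ∨' ψ) = renF ρ φ ∨' renF ρ ψ
renF ρ (φ ⇒ ψ)  = renF ρ φ ⇒ renF ρ ψ
renF ρ (∀' φ)   = ∀' (renF (extR ρ) φ)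
renF ρ (∃' φ)   = ∃' (renF (extR ρ) φ)

wkT : ∀ {n} → Term n → Term (suc n)
wkT = renT suc

wkF : ∀ {n} → Formula n → Formula (suc n)
wkF = renF suc

extS : ∀ {n m} → (Fin n → Term m) → Fin (suc n) → Term (suc m)
extS σ zero    = var zero
extS σ (suc i) = wkT (σ i)

subT : ∀ {n m} → (Fin n → Term m) → Term n → Term m
subT σ (var i)  = σ i
subT σ 𝟎        = 𝟎
subT σ (S' t)   = S' (subT σ t)
subT σ (t +' u) = subT σ t +' subT σ u
subT σ (t *' u) = subT σ t *' subT σ u
subT σ (exp' t) = exp' (subT σ t)

subF : ∀ {n m} → (Fin n → Term m) → Formula n → Formula m
subF σ ⊥'       = ⊥'
subF σ (t ≐ u)  = subT σ t ≐ subT σ u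
subF σ (t ≤' u) = subT σ t ≤' subT σ u
subF σ (φ ∧' ψ) = subF σ φ ∧' subF σ ψ
subF σ (φ ∨' ψ) = subF σ φ ∨' subF σ ψ
subF σ (φ ⇒ ψ)  = subF σ φ ⇒ subF σ ψ
subF σ (∀' φ)   = ∀' (subF (extS σ) φ)
subF σ (∃' φ)   = ∃' (subF (extS σ) φ)

_[_] : ∀ {n} → Formula (suc n) → Term n → Formula n
φ [ t ] = subF σ φ
  where
  σ : Fin (suc _) → Term _
  σ zero    = t
  σ (suc i) = var i

_∷ₑ_ : ∀ {n} → ℕ → (Fin n → ℕ) → Fin (suc n) → ℕ
(a ∷ₑ ρ) zero    = a
(a ∷ₑ ρ) (suc i) = ρ i

⟦_⟧ : ∀ {n} → Term n → (Fin n → ℕ) → ℕ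
⟦ var i ⟧  ρ = ρ i
⟦ 𝟎 ⟧      ρ = 0
⟦ S' t ⟧   ρ = suc (⟦ t ⟧ ρ)
⟦ t +' u ⟧ ρ = ⟦ t ⟧ ρ + ⟦ u ⟧ ρ
⟦ t *' u ⟧ ρ = ⟦ t ⟧ ρ * ⟦ u ⟧ ρ
⟦ exp' t ⟧ ρ = 2 ^ ⟦ t ⟧ ρ

Sat : ∀ {n} → Formula n → (Fin n → ℕ) → Set
Sat ⊥'       ρ = ⊥
Sat (t ≐ u)  ρ = ⟦ t ⟧ ρ ≡ ⟦ u ⟧ ρ
Sat (t ≤' u) ρ = ⟦ t ⟧ ρ ≤ ⟦ u ⟧ ρ
Sat (φ ∧' ψ) ρ = Sat φ ρ × Sat ψ ρ
Sat (φ ∨' ψ) ρ = Sat φ ρ ⊎ Sat ψ ρ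
Sat (φ ⇒ ψ)  ρ = Sat φ ρ → Sat ψ ρ
Sat (∀' φ)   ρ = (a : ℕ) → Sat φ (a ∷ₑ ρ)
Sat (∃' φ)   ρ = Σ ℕ λ a → Sat φ (a ∷ₑ ρ)

True : Sentence → Set
True φ = Sat φ (λ ())

infix 3 _⊩_

data _⊩_ : {n : ℕ} → List (Formula n) → Formula n → Set where
  assum : ∀ {n} {Γ : List (Formula n)} {φ} → φ ∈ Γ → Γ ⊩ φ
  raa   : ∀ {n} {Γ : List (Formula n)} {φ} → (¬' φ ∷ Γ) ⊩ ⊥' → Γ ⊩ φ
  ∧I    : ∀ {n} {Γ : List (Formula n)} {φ ψ} → Γ ⊩ φ → Γ ⊩ ψ → Γ ⊩ φ ∧' ψ
  ∧E₁   : ∀ {n} {Γ : List (Formula n)} {φ ψ} → Γ ⊩ φ ∧' ψ → Γ ⊩ φ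
  ∧E₂   : ∀ {n} {Γ : List (Formula n)} {φ ψ} → Γ ⊩ φ ∧' ψ → Γ ⊩ ψ
  ∨I₁   : ∀ {n} {Γ : List (Formula n)} {φ ψ} → Γ ⊩ φ → Γ ⊩ φ ∨' ψ
  ∨I₂   : ∀ {n} {Γ : List (Formula n)} {φ ψ} → Γ ⊩ ψ → Γ ⊩ φ ∨' ψ
  ∨E    : ∀ {n} {Γ : List (Formula n)} {φ ψ χ} →
          Γ ⊩ φ ∨' ψ → (φ ∷ Γ) ⊩ χ → (ψ ∷ Γ) ⊩ χ → Γ ⊩ χ
  ⇒I    : ∀ {n} {Γ : List (Formula n)} {φ ψ} → (φ ∷ Γ) ⊩ ψ → Γ ⊩ φ ⇒ ψ
  ⇒E    : ∀ {n} {Γ : List (Formula n)} {φ ψ} → Γ ⊩ φ ⇒ ψ → Γ ⊩ φ → Γ ⊩ ψ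
  ∀I    : ∀ {n} {Γ : List (Formula n)} {φ} → map wkF Γ ⊩ φ → Γ ⊩ ∀' φ
  ∀E    : ∀ {n} {Γ : List (Formula n)} {φ} → Γ ⊩ ∀' φ → (t : Term n) → Γ ⊩ φ [ t ]
  ∃I    : ∀ {n} {Γ : List (Formula n)} {φ} (t : Term n) → Γ ⊩ φ [ t ] → Γ ⊩ ∃' φ
  ∃E    : ∀ {n} {Γ : List (Formula n)} {φ χ} →
          Γ ⊩ ∃' φ → (φ ∷ map wkF Γ) ⊩ wkF χ → Γ ⊩ χ
  ≐refl : ∀ {n} {Γ : List (Formula n)} {t} → Γ ⊩ t ≐ t
  ≐E    : ∀ {n} {Γ : List (Formula n)} {t u φ} →
          Γ ⊩ t ≐ u → Γ ⊩ φ [ t ] → Γ ⊩ φ [ u ]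

-- A theory is given by its set of axioms (sentences).
Theory : Set₁
Theory = Sentence → Set

_⊢_ : Theory → Sentence → Set
T ⊢ φ = Σ (List Sentence) λ Δ → All T Δ × (Δ ⊩ φ)

_+ₜ_ : Theory → Sentence → Theory
(T +ₜ ψ) χ = T χ ⊎ χ ≡ ψ

Consistent : Theory → Set
Consistent T = ¬ (T ⊢ ⊥')

Sound : Theory → Set
Sound T = ∀ φ → T ⊢ φ → True φ

-- effectively axiomatized: the axiom set is decided by a (computable,
-- since every Agda function is) Boolean function
AxiomsOf : (Sentence → Bool) → Theory
AxiomsOf ax φ = ax φ ≡ true

close : ∀ {n} → Formula n → Sentence
close {zero}  φ = φ
close {suc n} φ = close (∀' φ)

∀≤ : ∀ {n} → Term n → Formula (suc n) → Formula n
∀≤ t φ = ∀' (var zero ≤' wkT t ⇒ φ)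

∃≤ : ∀ {n} → Term n → Formula (suc n) → Formula n
∃≤ t φ = ∃' (var zero ≤' wkT t ∧' φ)

data IsΔ₀ : {n : ℕ} → Formula n → Set where
  d⊥ : ∀ {n} → IsΔ₀ {n} ⊥'
  d≐ : ∀ {n} {t u : Term n} → IsΔ₀ (t ≐ u)
  d≤ : ∀ {n} {t u : Term n} → IsΔ₀ (t ≤' u)
  d∧ : ∀ {n} {φ ψ : Formula n} → IsΔ₀ φ → IsΔ₀ ψ → IsΔ₀ (φ ∧' ψ)
  d∨ : ∀ {n} {φ ψ : Formula n} → IsΔ₀ φ → IsΔ₀ ψ → IsΔ₀ (φ ∨' ψ)
  d⇒ : ∀ {n} {φ ψ : Formula n} → IsΔ₀ φ → IsΔ₀ ψ → IsΔ₀ (φ ⇒ ψ)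
  d∀≤ : ∀ {n} {t : Term n} {φ} → IsΔ₀ φ → IsΔ₀ (∀≤ t φ)
  d∃≤ : ∀ {n} {t : Term n} {φ} → IsΔ₀ φ → IsΔ₀ (∃≤ t φ)

private
  x₀ : ∀ {n} → Term (suc n)
  x₀ = var zero
  x₁ : ∀ {n} → Term (suc (suc n))
  x₁ = var (suc zero)
  x₂ : ∀ {n} → Term (suc (suc (suc n)))
  x₂ = var (suc (suc zero))

stepSub : ∀ {n} → Fin (suc n) → Term (suc n)
stepSub zero    = S' (var zero)
stepSub (suc i) = var (suc i)

data EAAxiom : Sentence → Set where
  ax-S≠0 : EAAxiom (close {1} (¬' (S' x₀ ≐ 𝟎)))
  ax-Sinj : EAAxiom (close {2} (S' x₀ ≐ S' x₁ ⇒ x₀ ≐ x₁))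
  ax-+0 : EAAxiom (close {1} (x₀ +' 𝟎 ≐ x₀))
  ax-+S : EAAxiom (close {2} (x₀ +' S' x₁ ≐ S' (x₀ +' x₁)))
  ax-*0 : EAAxiom (close {1} (x₀ *' 𝟎 ≐ 𝟎))
  ax-*S : EAAxiom (close {2} (x₀ *' S' x₁ ≐ (x₀ *' x₁) +' x₀))
  ax-exp0 : EAAxiom (exp' 𝟎 ≐ S' 𝟎)
  ax-expS : EAAxiom (close {1} (exp' (S' x₀) ≐ exp' x₀ +' exp' x₀))
  -- x ≤ y ↔ ∃z (x + z = y)
  ax-≤₁ : EAAxiom (close {2} (x₀ ≤' x₁ ⇒ ∃' (x₁ +' x₀ ≐ x₂)))
  ax-≤₂ : EAAxiom (close {2} (∃' (x₁ +' x₀ ≐ x₂) ⇒ x₀ ≤' x₁))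
  ax-ind : ∀ {n} (φ : Formula (suc n)) → IsΔ₀ φ →
           EAAxiom (close ((φ [ 𝟎 ] ∧' ∀' (φ ⇒ subF stepSub φ)) ⇒ ∀' φ))

ExtendsEA : Theory → Set
ExtendsEA T = ∀ φ → EAAxiom φ → T ⊢ φ

ExpressesCon : Theory → (Sentence → Sentence) → Set
ExpressesCon T Con = ∀ ψ → (True (Con ψ) → Consistent (T +ₜ ψ))
                         × (Consistent (T +ₜ ψ) → True (Con ψ))

Enumerates : (ℕ → Sentence) → Set
Enumerates φ = ∀ ψ → ∃ λ k → φ k ≡ ψ

-- The construction of 𝔄.
-- numerated φ Con n : sentences numerated into 𝔄 at stage n
-- active    φ Con n : sentences active at the end of stage n

withCon : (Sentence → Sentence) → Sentence → Sentence
withCon Con θ = θ ∧' Con θ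

numerated : (ℕ → Sentence) → (Sentence → Sentence) → ℕ → List Sentence
active    : (ℕ → Sentence) → (Sentence → Sentence) → ℕ → List Sentence

numerated φ Con zero    = φ 0 ∷ ¬' φ 0 ∷ []
numerated φ Con (suc n) =
  concatMap (λ ψ → ψ ∧' φ (suc n) ∷ ψ ∧' ¬' φ (suc n) ∷ []) (active φ Con n)

active φ Con n = map (withCon Con) (numerated φ Con n)

ExactlyOneTrue : List Sentence → Set
ExactlyOneTrue xs = Σ Sentence λ θ → θ ∈ xs × True θ ×
                      (∀ θ' → θ' ∈ xs → True θ' → θ' ≡ θ)

{-# OPTIONS --safe #-}
-- In ℕ, exactly one of φ₀ and ¬φ₀ is true, and if exactly one of the ψᵢ is
-- true then exactly one of the conjunctions ψᵢ ∧ χ, ψᵢ ∧ ¬χ is true.  Adding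
-- the conjunct Con_T(θ) changes nothing: a true θ is consistent with the sound
-- theory T, so Con_T(θ) is true as well.
module Submission where

open import Defs
open import Data.Nat using (ℕ; zero; suc)
open import Data.Bool using (Bool)
open import Data.Product using (Σ; _×_; _,_; proj₁; proj₂)
open import Data.Sum using (inj₁; inj₂)
open import Data.List using (List; []; _∷_; map; concatMap)
open import Data.List.Relation.Unary.All using (All; []; _∷_)
open import Data.List.Relation.Unary.Any using (here; there)
open import Data.List.Membership.Propositional using (_∈_; find; lose)
open import Data.List.Membership.Propositional.Properties using (∈-map⁺; ∈-map⁻; ∈-concatMap⁺; ∈-concatMap⁻)
open import Data.List.Relation.Binary.Subset.Propositional using (_⊆_)
open import Data.List.Relation.Binary.Subset.Propositional.Properties using (⊆-trans; map⁺; xs⊆x∷xs; ∷⁺ʳ; ∈-∷⁺ʳ)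
open import Relation.Nullary using (Dec; yes; no; contradiction)
open import Relation.Binary.PropositionalEquality using (_≡_; refl; cong; cong₂)
open import Level using (0ℓ)
open import Axiom.ExcludedMiddle using (ExcludedMiddle)

⊩-weaken : ∀ {n} {Γ Δ : List (Formula n)} {φ} → Γ ⊆ Δ → Γ ⊩ φ → Δ ⊩ φ
⊩-weaken Γ⊆Δ (assum φ∈Γ) = assum (Γ⊆Δ φ∈Γ)
⊩-weaken Γ⊆Δ (raa d)     = raa (⊩-weaken (∷⁺ʳ _ Γ⊆Δ) d)
⊩-weaken Γ⊆Δ (∧I d e)    = ∧I (⊩-weaken Γ⊆Δ d) (⊩-weaken Γ⊆Δ e)
⊩-weaken Γ⊆Δ (∧E₁ d)     = ∧E₁ (⊩-weaken Γ⊆Δ d)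
⊩-weaken Γ⊆Δ (∧E₂ d)     = ∧E₂ (⊩-weaken Γ⊆Δ d)
⊩-weaken Γ⊆Δ (∨I₁ d)     = ∨I₁ (⊩-weaken Γ⊆Δ d)
⊩-weaken Γ⊆Δ (∨I₂ d)     = ∨I₂ (⊩-weaken Γ⊆Δ d)
⊩-weaken Γ⊆Δ (∨E d e f)  =
  ∨E (⊩-weaken Γ⊆Δ d) (⊩-weaken (∷⁺ʳ _ Γ⊆Δ) e) (⊩-weaken (∷⁺ʳ _ Γ⊆Δ) f)
⊩-weaken Γ⊆Δ (⇒I d)      = ⇒I (⊩-weaken (∷⁺ʳ _ Γ⊆Δ) d)
⊩-weaken Γ⊆Δ (⇒E d e)    = ⇒E (⊩-weaken Γ⊆Δ d) (⊩-weaken Γ⊆Δ e)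
⊩-weaken Γ⊆Δ (∀I d)      = ∀I (⊩-weaken (map⁺ wkF Γ⊆Δ) d)
⊩-weaken Γ⊆Δ (∀E d t)    = ∀E (⊩-weaken Γ⊆Δ d) t
⊩-weaken Γ⊆Δ (∃I t d)    = ∃I t (⊩-weaken Γ⊆Δ d)
⊩-weaken Γ⊆Δ (∃E d e)    = ∃E (⊩-weaken Γ⊆Δ d) (⊩-weaken (∷⁺ʳ _ (map⁺ wkF Γ⊆Δ)) e)
⊩-weaken Γ⊆Δ ≐refl       = ≐refl
⊩-weaken Γ⊆Δ (≐E d e)    = ≐E (⊩-weaken Γ⊆Δ d) (⊩-weaken Γ⊆Δ e)

+ₜ-axioms-split : ∀ {T : Theory} {θ : Sentence} (Δ : List Sentence) → All (T +ₜ θ) Δ →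
                  Σ (List Sentence) λ Δ′ → All T Δ′ × Δ ⊆ θ ∷ Δ′
+ₜ-axioms-split []      []               = [] , [] , λ ()
+ₜ-axioms-split (χ ∷ Δ) (inj₁ Tχ ∷ axs)  with Δ′ , axs′ , Δ⊆θ∷Δ′ ← +ₜ-axioms-split Δ axs =
  χ ∷ Δ′ , Tχ ∷ axs′ , ∈-∷⁺ʳ (there (here refl)) (⊆-trans Δ⊆θ∷Δ′ (∷⁺ʳ _ (xs⊆x∷xs Δ′ χ)))
+ₜ-axioms-split (χ ∷ Δ) (inj₂ refl ∷ axs) with Δ′ , axs′ , Δ⊆θ∷Δ′ ← +ₜ-axioms-split Δ axs =
  Δ′ , axs′ , ∈-∷⁺ʳ (here refl) Δ⊆θ∷Δ′

deduction : ∀ {T : Theory} {θ ψ : Sentence} → (T +ₜ θ) ⊢ ψ → T ⊢ (θ ⇒ ψ)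
deduction (Δ , axs , d) with Δ′ , axs′ , Δ⊆θ∷Δ′ ← +ₜ-axioms-split Δ axs =
  Δ′ , axs′ , ⇒I (⊩-weaken Δ⊆θ∷Δ′ d)

sound⇒true-consistent : ∀ {T : Theory} {θ : Sentence} → Sound T → True θ → Consistent (T +ₜ θ)
sound⇒true-consistent {θ = θ} sound θ-true T+θ⊢⊥ = sound (¬' θ) (deduction T+θ⊢⊥) θ-true

sound⇒Con-true : ∀ {T : Theory} {Con : Sentence → Sentence} {θ : Sentence} →
                 Sound T → ExpressesCon T Con → True θ → True (Con θ)
sound⇒Con-true {θ = θ} sound expressesCon θ-true =
  proj₂ (expressesCon θ) (sound⇒true-consistent sound θ-true)

exactlyOneTrue-dichotomy : ∀ {χ} → Dec (True χ) → ExactlyOneTrue (χ ∷ ¬' χ ∷ [])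
exactlyOneTrue-dichotomy {χ} (yes χ-true) = χ , here refl , χ-true , unique
  where
  unique : ∀ θ → θ ∈ χ ∷ ¬' χ ∷ [] → True θ → θ ≡ χ
  unique _ (here refl)         _       = refl
  unique _ (there (here refl)) ¬χ-true = contradiction χ-true ¬χ-true
exactlyOneTrue-dichotomy {χ} (no χ-false) = ¬' χ , there (here refl) , χ-false , unique
  where
  unique : ∀ θ → θ ∈ χ ∷ ¬' χ ∷ [] → True θ → θ ≡ ¬' χ
  unique _ (here refl)         χ-true = contradiction χ-true χ-false
  unique _ (there (here refl)) _      = refl

exactlyOneTrue-map : ∀ {xs} (f : Sentence → Sentence) →
                     (∀ θ → True θ → True (f θ)) → (∀ θ → True (f θ) → True θ) →
                     ExactlyOneTrue xs → ExactlyOneTrue (map f xs)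
exactlyOneTrue-map f preserves reflects (θ , θ∈xs , θ-true , unique) =
  f θ , ∈-map⁺ f θ∈xs , preserves θ θ-true , unique′
  where
  unique′ : ∀ θ′ → θ′ ∈ map f _ → True θ′ → θ′ ≡ f θ
  unique′ _ fθ′∈ fθ′-true with θ′ , θ′∈xs , refl ← ∈-map⁻ f fθ′∈ =
    cong f (unique θ′ θ′∈xs (reflects θ′ fθ′-true))

conjunctions : List Sentence → List Sentence → List Sentence
conjunctions xs ys = concatMap (λ x → map (x ∧'_) ys) xs

exactlyOneTrue-conjunctions : ∀ {xs ys} → ExactlyOneTrue xs → ExactlyOneTrue ys →
                              ExactlyOneTrue (conjunctions xs ys)
exactlyOneTrue-conjunctions {xs} {ys} (x , x∈xs , x-true , uniqueˣ) (y , y∈ys , y-true , uniqueʸ) =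
  x ∧' y , ∈-concatMap⁺ _∧ys (lose x∈xs (∈-map⁺ (x ∧'_) y∈ys)) , (x-true , y-true) , unique
  where
  _∧ys : Sentence → List Sentence
  x′ ∧ys = map (x′ ∧'_) ys

  unique : ∀ θ → θ ∈ conjunctions xs ys → True θ → θ ≡ x ∧' y
  unique θ θ∈ θ-true with x′ , x′∈xs , θ∈x′∧ys ← find (∈-concatMap⁻ _∧ys {xs = xs} θ∈)
                     with y′ , y′∈ys , refl ← ∈-map⁻ (x′ ∧'_) θ∈x′∧ys =
    cong₂ _∧'_ (uniqueˣ x′ x′∈xs (proj₁ θ-true)) (uniqueʸ y′ y′∈ys (proj₂ θ-true))

lemma3p2 : ExcludedMiddle 0ℓ →
    (ax : Sentence → Bool) → ExtendsEA (AxiomsOf ax) → Sound (AxiomsOf ax) →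
    (φ : ℕ → Sentence) → Enumerates φ →
    (Con : Sentence → Sentence) → ExpressesCon (AxiomsOf ax) Con →
    (n : ℕ) → ExactlyOneTrue (active φ Con n) × ExactlyOneTrue (numerated φ Con n)
lemma3p2 lem _ _ sound φ _ Con expressesCon n = active-one n (numerated-one n) , numerated-one n
  where
  active-one : ∀ n → ExactlyOneTrue (numerated φ Con n) → ExactlyOneTrue (active φ Con n)
  active-one n = exactlyOneTrue-map (withCon Con)
    (λ θ θ-true → θ-true , sound⇒Con-true sound expressesCon θ-true)
    (λ θ → proj₁)

  numerated-one : ∀ n → ExactlyOneTrue (numerated φ Con n)
  numerated-one zero    = exactlyOneTrue-dichotomy lem
  numerated-one (suc n) =
    exactlyOneTrue-conjunctions (active-one n (numerated-one n)) (exactlyOneTrue-dichotomy lem)
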